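{- The subset $$S^\dagger=\Big\{\sum_{i\ge0}b_i\tau^i\in R\{\tau\}^\wedge\ :\ b_i\in\pi^iR\text{ for all }i\ge0,\ b_0\in R^*\Big\}$$ is a group under composition.
   Context: $q=p^h$ is a prime power; $R$ is an $\mathbb F_q$-algebra (in the paper, an algebra over the completion $\hat A$ of a function ring over $\mathbb F_q$) which is $\pi$-adically complete and $\pi$-torsion free, with $\pi$ a fixed element (a uniformizer of $\hat A$). $R\{\tau\}^\wedge$ is the set of formal sums $\sum_{i\ge0}b_i\tau^i$ with $b_i\in R$ and $b_i\to0$ $\pi$-adically, with composition given by $b\tau^i\circ c\tau^j=bc^{q^i}\tau^{i+j}$ extended bilinearly (this corresponds to composition of the additive maps $x\mapsto\sum b_ix^{q^i}$). -}

module Defs where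

open import Level using (Level; _⊔_)
open import Algebra.Bundles using (CommutativeRing)
open import Data.Nat using (ℕ; zero; suc; _∸_) renaming (_^_ to _^ℕ_)
open import Data.Product using (Σ; ∃; _×_)
open import Relation.Nullary using (¬_)

module _ {c ℓ : Level} (R : CommutativeRing c ℓ) where
  open CommutativeRing R

  pow : Carrier → ℕ → Carrier
  pow x zero    = 1#
  pow x (suc n) = x * pow x n

  natCast : ℕ → Carrier
  natCast zero    = 0#
  natCast (suc n) = 1# + natCast n

  Divides : Carrier → Carrier → Set (c ⊔ ℓ)
  Divides a x = Σ Carrier (λ r → x ≈ a * r)

  IsUnit : Carrier → Set (c ⊔ ℓ)
  IsUnit x = Σ Carrier (λ u → x * u ≈ 1#)

  TorsionFree : Carrier → Set (c ⊔ ℓ)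
  TorsionFree π = ∀ x → π * x ≈ 0# → x ≈ 0#

  PiAdicallySeparated : Carrier → Set (c ⊔ ℓ)
  PiAdicallySeparated π = ∀ x → (∀ n → Divides (pow π n) x) → x ≈ 0#

  PiAdicallyComplete : Carrier → Set (c ⊔ ℓ)
  PiAdicallyComplete π =
    PiAdicallySeparated π ×
    (∀ (x : ℕ → Carrier) → (∀ n → Divides (pow π n) (x (suc n) - x n)) →
       Σ Carrier (λ y → ∀ n → Divides (pow π n) (y - x n)))

  -- Elements of R{τ}^ are represented by coefficient sequences i ↦ bᵢ.
  Series : Set c
  Series = ℕ → Carrier

  TendsToZero : Carrier → Series → Set (c ⊔ ℓ)
  TendsToZero π b = ∀ n → Σ ℕ (λ N → ∀ i → Data.Nat._≤_ N i → Divides (pow π n) (b i))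

  _≈S_ : Series → Series → Set ℓ
  f ≈S g = ∀ n → f n ≈ g n

  sumTo : ℕ → (ℕ → Carrier) → Carrier
  sumTo zero    f = f 0
  sumTo (suc n) f = sumTo n f + f (suc n)

  -- composition: (Σ bᵢτⁱ) ∘ (Σ cⱼτʲ) = Σₙ (Σ_{i+j=n} bᵢ cⱼ^{q^i}) τⁿ
  compose : ℕ → Series → Series → Series
  compose q b c n = sumTo n (λ i → b i * pow (c (n ∸ i)) (q ^ℕ i))

  idS : Series
  idS zero    = 1#
  idS (suc n) = 0#

  InSdagger : Carrier → Series → Set (c ⊔ ℓ)
  InSdagger π b = (∀ i → Divides (pow π i) (b i)) × IsUnit (b 0)

  record IsGroupUnder (comp : Series → Series → Series) (S : Series → Set (c ⊔ ℓ)) : Set (c ⊔ ℓ) where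
    field
      resp     : ∀ {f g} → S f → f ≈S g → S g
      cong     : ∀ {f f' g g'} → S f → S f' → S g → S g' → f ≈S f' → g ≈S g' →
                 comp f g ≈S comp f' g'
      closed   : ∀ {f g} → S f → S g → S (comp f g)
      id∈      : S idS
      assoc    : ∀ {f g h} → S f → S g → S h → comp (comp f g) h ≈S comp f (comp g h)
      identityˡ : ∀ {f} → S f → comp idS f ≈S f
      identityʳ : ∀ {f} → S f → comp f idS ≈S f
      inverse  : ∀ {f} → S f → Σ Series (λ g → S g × (comp f g ≈S idS) × (comp g f ≈S idS))

module Submission where

-- As p divides the interior binomial coefficients (p C k), in characteristic
-- p the Frobenius x ↦ x^p is additive, hence so is x ↦ x^q, and every φᵢ is a
-- ring endomorphism with φᵢ ∘ φⱼ = φ_{i+j}.  Associativity of ∘ is then the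
-- exchange of a triangular double sum, and the unit laws are immediate.  As
-- φᵢ preserves π-divisibility, bᵢ ∈ πⁱR is stable under ∘ (and forces bᵢ → 0).
-- When b₀ is a unit, (b ∘ c)ₙ = δ_{n0} is solved recursively for a right
-- inverse c; a right inverse that itself has a right inverse is two-sided.

open import Defs
open import Level using (Level)
open import Algebra.Bundles using (CommutativeRing)
open import Data.Nat using (ℕ; suc; _^_)
open import Data.Nat.Primality using (Prime)
open import Data.Product using (_×_)
open import Relation.Binary.PropositionalEquality using (_≡_)

open import Level using (_⊔_)
open import Data.Nat using (zero; z≤n; s≤s; _∸_; NonZero) renaming (_≤_ to _≤ℕ_; _<_ to _<ℕ_)
open import Data.Nat.Primality using (prime⇒nonZero)
import Data.Nat as ℕ
import Data.Nat.Properties as ℕP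
open import Data.Product using (Σ; _,_)
open import Data.Sum using (inj₁; inj₂)
open import Function using (_∘_)
import Relation.Binary.PropositionalEquality as ≡

module PrimeBinomial where
  open import Data.Nat
  open import Data.Nat.Properties
  open import Data.Nat.Divisibility
  open import Data.Nat.DivMod using (m/n*n≡m)
  open import Data.Nat.Combinatorics using (_C_; nCk≡n!/k![n-k]!; k![n∸k]!∣n!)
  open import Data.Nat.Primality
  open import Data.Empty using (⊥-elim)
  open import Relation.Binary.PropositionalEquality

  -- p ∤ m! for m < p, since p divides none of the factors 1, …, m.
  prime∤factorial : ∀ {p} → Prime p → ∀ m → m < p → p ∤ m !
  prime∤factorial p-prime zero _ p∣1 = ¬prime[1] (subst Prime (∣1⇒≡1 p∣1) p-prime)
  prime∤factorial p-prime (suc m) m<p p∣m! with euclidsLemma (suc m) (m !) p-prime p∣m!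
  ... | inj₁ p∣1+m = >⇒∤ m<p p∣1+m
  ... | inj₂ p∣m!′ = prime∤factorial p-prime m (<-trans (n<1+n m) m<p) p∣m!′

  binomial-factorials : ∀ {n k} → k ≤ n → (n C k) * (k ! * (n ∸ k) !) ≡ n !
  binomial-factorials {n} {k} k≤n =
    trans (cong (_* (k ! * (n ∸ k) !)) (nCk≡n!/k![n-k]! k≤n)) (m/n*n≡m (k![n∸k]!∣n! k≤n))
    where instance _ = k !* (n ∸ k) !≢0

  -- p divides p! = (p C k) · k! · (p-k)!, but divides neither k! nor (p-k)!.
  prime∣binomial : ∀ {p k} → Prime p → 0 < k → k < p → p ∣ p C k
  prime∣binomial {p@(suc p-1)} {k} p-prime 0<k k<p
    with euclidsLemma (p C k) (k ! * (p ∸ k) !) p-prime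
           (subst (p ∣_) (sym (binomial-factorials (<⇒≤ k<p))) (m∣m*n (p-1 !)))
  ... | inj₁ p∣C = p∣C
  ... | inj₂ p∣k![p-k]! with euclidsLemma (k !) ((p ∸ k) !) p-prime p∣k![p-k]!
  ...   | inj₁ p∣k! = ⊥-elim (prime∤factorial p-prime k k<p p∣k!)
  ...   | inj₂ p∣[p-k]! = ⊥-elim (prime∤factorial p-prime (p ∸ k) (∸-monoʳ-< 0<k (<⇒≤ k<p)) p∣[p-k]!)

module Sums {c ℓ : Level} (R : CommutativeRing c ℓ) where
  open CommutativeRing R
  open import Relation.Binary.Reasoning.Setoid setoid
  open import Algebra.Properties.CommutativeSemigroup +-commutativeSemigroup using (interchange)

  ∑ : ℕ → (ℕ → Carrier) → Carrier
  ∑ = sumTo R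

  ∑-cong≤ : ∀ n {f g : ℕ → Carrier} → (∀ i → i ≤ℕ n → f i ≈ g i) → ∑ n f ≈ ∑ n g
  ∑-cong≤ zero    f≈g = f≈g 0 z≤n
  ∑-cong≤ (suc n) f≈g =
    +-cong (∑-cong≤ n (λ i i≤n → f≈g i (ℕP.m≤n⇒m≤1+n i≤n))) (f≈g (suc n) ℕP.≤-refl)

  ∑-cong : ∀ n {f g : ℕ → Carrier} → (∀ i → f i ≈ g i) → ∑ n f ≈ ∑ n g
  ∑-cong n f≈g = ∑-cong≤ n (λ i _ → f≈g i)

  ∑-suc : ∀ n (f : ℕ → Carrier) → ∑ (suc n) f ≈ f 0 + ∑ n (f ∘ suc)
  ∑-suc zero    f = refl
  ∑-suc (suc n) f = trans (+-congʳ (∑-suc n f)) (+-assoc _ _ _)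

  ∑-snoc : ∀ {m} k (f : ℕ → Carrier) → m ≡ suc k → ∑ m f ≈ ∑ k f + f m
  ∑-snoc k f ≡.refl = refl

  ∑-single : ∀ {m} (f : ℕ → Carrier) → m ≡ 0 → ∑ m f ≈ f m
  ∑-single f ≡.refl = refl

  ∑-+ : ∀ n (f g : ℕ → Carrier) → ∑ n (λ i → f i + g i) ≈ ∑ n f + ∑ n g
  ∑-+ zero    f g = refl
  ∑-+ (suc n) f g = trans (+-congʳ (∑-+ n f g)) (interchange _ _ _ _)

  ∑-*ˡ : ∀ n a (f : ℕ → Carrier) → a * ∑ n f ≈ ∑ n (λ i → a * f i)
  ∑-*ˡ zero    a f = refl
  ∑-*ˡ (suc n) a f = trans (distribˡ a _ _) (+-congʳ (∑-*ˡ n a f))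

  ∑-*ʳ : ∀ n a (f : ℕ → Carrier) → ∑ n f * a ≈ ∑ n (λ i → f i * a)
  ∑-*ʳ zero    a f = refl
  ∑-*ʳ (suc n) a f = trans (distribʳ a _ _) (+-congʳ (∑-*ʳ n a f))

  ∑-zero : ∀ n {f : ℕ → Carrier} → (∀ i → i ≤ℕ n → f i ≈ 0#) → ∑ n f ≈ 0#
  ∑-zero n {f} f≈0 = trans (∑-cong≤ n f≈0) (zeros n)
    where
    zeros : ∀ n → ∑ n (λ _ → 0#) ≈ 0#
    zeros zero    = refl
    zeros (suc n) = trans (+-identityʳ _) (zeros n)

  ∑-first : ∀ n {f : ℕ → Carrier} → (∀ i → suc i ≤ℕ n → f (suc i) ≈ 0#) → ∑ n f ≈ f 0
  ∑-first zero    f≈0 = refl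
  ∑-first (suc n) {f} f≈0 = begin
    ∑ (suc n) f           ≈⟨ ∑-suc n f ⟩
    f 0 + ∑ n (f ∘ suc)   ≈⟨ +-congˡ (∑-zero n (λ i i≤n → f≈0 i (s≤s i≤n))) ⟩
    f 0 + 0#              ≈⟨ +-identityʳ _ ⟩
    f 0                   ∎

  ∑-last : ∀ n {f : ℕ → Carrier} → (∀ i → i <ℕ n → f i ≈ 0#) → ∑ n f ≈ f n
  ∑-last zero    f≈0 = refl
  ∑-last (suc n) f≈0 = trans (+-congʳ (∑-zero n (λ i i≤n → f≈0 i (s≤s i≤n)))) (+-identityˡ _)

  ∑-ends : ∀ n .{{_ : NonZero n}} {f : ℕ → Carrier} →
           (∀ i → 0 <ℕ i → i <ℕ n → f i ≈ 0#) → ∑ n f ≈ f 0 + f n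
  ∑-ends (suc m) {f} f≈0 =
    trans (∑-suc m f) (+-congˡ (∑-last m (λ i i<m → f≈0 (suc i) (s≤s z≤n) (s≤s i<m))))

  ∑-triangle : ∀ n (h : ℕ → ℕ → Carrier) →
               ∑ n (λ k → ∑ k (λ i → h i (k ∸ i))) ≈ ∑ n (λ i → ∑ (n ∸ i) (h i))
  ∑-triangle zero    h = refl
  ∑-triangle (suc n) h = begin
    ∑ n (λ k → ∑ k (λ i → h i (k ∸ i))) + (diagonal + h (suc n) (n ∸ n))
      ≈⟨ +-cong (∑-triangle n h) (+-congˡ (sym (∑-single (h (suc n)) (ℕP.n∸n≡0 n)))) ⟩
    ∑ n (λ i → ∑ (n ∸ i) (h i)) + (diagonal + ∑ (n ∸ n) (h (suc n)))
      ≈⟨ sym (+-assoc _ _ _) ⟩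
    (∑ n (λ i → ∑ (n ∸ i) (h i)) + diagonal) + ∑ (n ∸ n) (h (suc n))
      ≈⟨ +-congʳ (sym rows) ⟩
    ∑ n (λ i → ∑ (suc n ∸ i) (h i)) + ∑ (n ∸ n) (h (suc n))
      ∎
    where
    -- the new anti-diagonal  i + j = n + 1,  without its corner i = n + 1
    diagonal = ∑ n (λ i → h i (suc n ∸ i))
    rows : ∑ n (λ i → ∑ (suc n ∸ i) (h i)) ≈ ∑ n (λ i → ∑ (n ∸ i) (h i)) + diagonal
    rows = trans (∑-cong≤ n (λ i i≤n → ∑-snoc (n ∸ i) (h i) (ℕP.+-∸-assoc 1 i≤n)))
                 (∑-+ n _ _)

module Divisibility {c ℓ : Level} (R : CommutativeRing c ℓ) where
  open CommutativeRing R
  open Sums R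
  open import Algebra.Properties.Ring ring using (-‿distribʳ-*)
  open import Algebra.Properties.CommutativeSemigroup *-commutativeSemigroup using (interchange)

  infix 4 _∣_
  _∣_ : Carrier → Carrier → Set (c ⊔ ℓ)
  _∣_ = Divides R

  ∣-respʳ : ∀ {a x y} → a ∣ x → x ≈ y → a ∣ y
  ∣-respʳ (r , x≈ar) x≈y = r , trans (sym x≈y) x≈ar

  ∣-respˡ : ∀ {a b x} → a ∣ x → a ≈ b → b ∣ x
  ∣-respˡ (r , x≈ar) a≈b = r , trans x≈ar (*-congʳ a≈b)

  ∣-0 : ∀ a → a ∣ 0#
  ∣-0 a = 0# , sym (zeroʳ a)

  ∣-+ : ∀ {a x y} → a ∣ x → a ∣ y → a ∣ x + y
  ∣-+ {a} (r , x≈ar) (s , y≈as) = r + s , trans (+-cong x≈ar y≈as) (sym (distribˡ a r s))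

  ∣-neg : ∀ {a x} → a ∣ x → a ∣ - x
  ∣-neg {a} (r , x≈ar) = - r , trans (-‿cong x≈ar) (-‿distribʳ-* a r)

  ∣-*ʳ : ∀ {a x} y → a ∣ x → a ∣ x * y
  ∣-*ʳ y (r , x≈ar) = r * y , trans (*-congʳ x≈ar) (*-assoc _ _ _)

  ∣-*ˡ : ∀ {a} x {y} → a ∣ y → a ∣ x * y
  ∣-*ˡ x a∣y = ∣-respʳ (∣-*ʳ x a∣y) (*-comm _ _)

  ∣-* : ∀ {a b x y} → a ∣ x → b ∣ y → a * b ∣ x * y
  ∣-* (r , x≈ar) (s , y≈bs) = r * s , trans (*-cong x≈ar y≈bs) (interchange _ _ _ _)

  ∣-trans : ∀ {a b x} → a ∣ b → b ∣ x → a ∣ x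
  ∣-trans (r , b≈ar) (s , x≈bs) = r * s , trans x≈bs (trans (*-congʳ b≈ar) (*-assoc _ _ _))

  ∣-∑ : ∀ n {a} {f : ℕ → Carrier} → (∀ i → i ≤ℕ n → a ∣ f i) → a ∣ ∑ n f
  ∣-∑ zero    a∣f = a∣f 0 z≤n
  ∣-∑ (suc n) a∣f = ∣-+ (∣-∑ n (λ i i≤n → a∣f i (ℕP.m≤n⇒m≤1+n i≤n))) (a∣f (suc n) ℕP.≤-refl)

  unit-* : ∀ {x y} → IsUnit R x → IsUnit R y → IsUnit R (x * y)
  unit-* (u , xu≈1) (v , yv≈1) =
    u * v , trans (interchange _ _ _ _) (trans (*-cong xu≈1 yv≈1) (*-identityˡ 1#))

  unit-resp : ∀ {x y} → IsUnit R x → x ≈ y → IsUnit R y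
  unit-resp (u , xu≈1) x≈y = u , trans (*-congʳ (sym x≈y)) xu≈1

module Powers {c ℓ : Level} (R : CommutativeRing c ℓ) where
  open CommutativeRing R
  open import Algebra.Properties.CommutativeSemiring.Exp commutativeSemiring
    using (^-congˡ; ^-homo-*; ^-assocʳ; ^-distrib-*) renaming (_^_ to _^ᴿ_)
  open Divisibility R using (_∣_; ∣-*ʳ)

  infixr 8 _↑_
  _↑_ : Carrier → ℕ → Carrier
  _↑_ = pow R

  ↑≈^ : ∀ x n → x ↑ n ≈ x ^ᴿ n
  ↑≈^ x zero    = refl
  ↑≈^ x (suc n) = *-congˡ (↑≈^ x n)

  ↑-cong : ∀ n {x y} → x ≈ y → x ↑ n ≈ y ↑ n
  ↑-cong n x≈y = trans (↑≈^ _ n) (trans (^-congˡ n x≈y) (sym (↑≈^ _ n)))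

  ↑-+ : ∀ x m n → x ↑ (m ℕ.+ n) ≈ x ↑ m * x ↑ n
  ↑-+ x m n = trans (↑≈^ x (m ℕ.+ n)) (trans (^-homo-* x m n) (sym (*-cong (↑≈^ x m) (↑≈^ x n))))

  ↑-split : ∀ x {i n} → i ≤ℕ n → x ↑ i * x ↑ (n ∸ i) ≈ x ↑ n
  ↑-split x {i} {n} i≤n = trans (sym (↑-+ x i (n ∸ i))) (reflexive (≡.cong (x ↑_) (ℕP.m+[n∸m]≡n i≤n)))

  ↑-* : ∀ x m n → x ↑ (m ℕ.* n) ≈ (x ↑ m) ↑ n
  ↑-* x m n = trans (↑≈^ x (m ℕ.* n)) (trans (sym (^-assocʳ x m n))
                (sym (trans (↑≈^ _ n) (^-congˡ n (↑≈^ x m)))))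

  ↑-distrib-* : ∀ x y n → (x * y) ↑ n ≈ x ↑ n * y ↑ n
  ↑-distrib-* x y n = trans (↑≈^ _ n) (trans (^-distrib-* x y n) (sym (*-cong (↑≈^ x n) (↑≈^ y n))))

  1↑ : ∀ n → 1# ↑ n ≈ 1#
  1↑ zero    = refl
  1↑ (suc n) = trans (*-identityˡ _) (1↑ n)

  ∣-↑ : ∀ {a x} n → .{{NonZero n}} → a ∣ x → a ∣ x ↑ n
  ∣-↑ (suc n) a∣x = ∣-*ʳ _ a∣x

module AdditiveExponents {c ℓ : Level} (R : CommutativeRing c ℓ) where
  open CommutativeRing R
  open import Relation.Binary.Reasoning.Setoid setoid
  open import Algebra.Properties.Ring ring using (x+x≈x⇒x≈0)
  open Sums R
  open Powers R

  Additive : ℕ → Set (c ⊔ ℓ)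
  Additive e = ∀ x y → (x + y) ↑ e ≈ x ↑ e + y ↑ e

  additive-1 : Additive 1
  additive-1 x y = trans (*-identityʳ _) (sym (+-cong (*-identityʳ x) (*-identityʳ y)))

  additive-* : ∀ {a b} → Additive a → Additive b → Additive (a ℕ.* b)
  additive-* {a} {b} add-a add-b x y = begin
    (x + y) ↑ (a ℕ.* b)             ≈⟨ ↑-* (x + y) a b ⟩
    ((x + y) ↑ a) ↑ b               ≈⟨ ↑-cong b (add-a x y) ⟩
    (x ↑ a + y ↑ a) ↑ b             ≈⟨ add-b _ _ ⟩
    (x ↑ a) ↑ b + (y ↑ a) ↑ b       ≈⟨ sym (+-cong (↑-* x a b) (↑-* y a b)) ⟩
    x ↑ (a ℕ.* b) + y ↑ (a ℕ.* b)   ∎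

  additive-^ : ∀ {e} → Additive e → ∀ i → Additive (e ^ i)
  additive-^ add-e zero    = additive-1
  additive-^ {e} add-e (suc i) = additive-* {e} {e ^ i} add-e (additive-^ add-e i)

  -- An additive power fixes 0, since 0^e + 0^e = (0 + 0)^e = 0^e.
  additive-0 : ∀ {e} → Additive e → 0# ↑ e ≈ 0#
  additive-0 {e} add-e = x+x≈x⇒x≈0 _ (trans (sym (add-e 0# 0#)) (↑-cong e (+-identityˡ 0#)))

  additive-∑ : ∀ {e} → Additive e → ∀ n (f : ℕ → Carrier) → ∑ n f ↑ e ≈ ∑ n (λ i → f i ↑ e)
  additive-∑ add-e zero    f = refl
  additive-∑ {e} add-e (suc n) f = trans (add-e (∑ n f) (f (suc n))) (+-congʳ (additive-∑ {e} add-e n f))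

module Frobenius {c ℓ : Level} (R : CommutativeRing c ℓ) (p : ℕ) (p-prime : Prime p)
  (char : CommutativeRing._≈_ R (natCast R p) (CommutativeRing.0# R)) where
  open CommutativeRing R
  open import Relation.Binary.Reasoning.Setoid setoid
  open import Data.Fin using (toℕ)
  open import Data.Nat.Divisibility using (divides)
  open import Data.Nat.Combinatorics using (_C_; nCn≡1)
  open import Algebra.Properties.CommutativeSemiring.Exp commutativeSemiring using () renaming (_^_ to _^ᴿ_)
  open import Algebra.Properties.Semiring.Mult semiring using (×-assoc-*) renaming (_×_ to _·_)
  open import Algebra.Properties.Monoid.Mult +-monoid using (×-congˡ; ×-congʳ; ×-assocˡ; ×-homo-1)
  open import Algebra.Properties.Monoid.Sum +-monoid using (sum)
  import Algebra.Properties.CommutativeSemiring.Binomial commutativeSemiring as Binomial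
  open PrimeBinomial using (prime∣binomial)
  open Sums R
  open Powers R
  open AdditiveExponents R

  natCast≡· : ∀ n → natCast R n ≡ n · 1#
  natCast≡· zero    = ≡.refl
  natCast≡· (suc n) = ≡.cong (1# +_) (natCast≡· n)

  p·≈0 : ∀ z → p · z ≈ 0#
  p·≈0 z = begin
    p · z            ≈⟨ ×-congʳ p (sym (*-identityˡ z)) ⟩
    p · (1# * z)     ≈⟨ sym (×-assoc-* p 1# z) ⟩
    (p · 1#) * z     ≈⟨ *-congʳ (trans (reflexive (≡.sym (natCast≡· p))) char) ⟩
    0# * z           ≈⟨ zeroˡ z ⟩
    0#               ∎

  interior-binomial≈0 : ∀ {k} z → 0 <ℕ k → k <ℕ p → (p C k) · z ≈ 0#
  interior-binomial≈0 {k} z 0<k k<p with prime∣binomial p-prime 0<k k<p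
  ... | divides r C≡r*p = begin
    (p C k) · z        ≈⟨ ×-congˡ (≡.trans C≡r*p (ℕP.*-comm r p)) ⟩
    (p ℕ.* r) · z      ≈⟨ sym (×-assocˡ z p r) ⟩
    p · (r · z)        ≈⟨ p·≈0 (r · z) ⟩
    0#                 ∎

  -- The library's binomial expansion, a sum over Fin (suc n), as a ∑.
  sum≈∑ : ∀ n (f : ℕ → Carrier) → sum {suc n} (f ∘ toℕ) ≈ ∑ n f
  sum≈∑ zero    f = +-identityʳ _
  sum≈∑ (suc n) f = trans (+-congˡ (sum≈∑ n (f ∘ suc))) (sym (∑-suc n f))

  frobenius : Additive p
  frobenius x y = begin
    (x + y) ↑ p                        ≈⟨ ↑≈^ (x + y) p ⟩
    (x + y) ^ᴿ p                       ≈⟨ Binomial.theorem p x y ⟩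
    Binomial.binomialExpansion x y p   ≈⟨ sum≈∑ p term ⟩
    ∑ p term                           ≈⟨ ∑-ends p {{prime⇒nonZero p-prime}}
                                            (λ k 0<k k<p → interior-binomial≈0 _ 0<k k<p) ⟩
    term 0 + term p                    ≈⟨ +-comm _ _ ⟩
    term p + term 0                    ≈⟨ +-cong last first ⟩
    x ↑ p + y ↑ p                      ∎
    where
    term : ℕ → Carrier
    term k = (p C k) · (x ^ᴿ k * y ^ᴿ (p ∸ k))
    first : term 0 ≈ y ↑ p
    first = trans (×-homo-1 _) (trans (*-identityˡ _) (sym (↑≈^ y p)))
    last : term p ≈ x ↑ p
    last = begin
      (p C p) · (x ^ᴿ p * y ^ᴿ (p ∸ p))   ≈⟨ ×-congˡ (nCn≡1 p) ⟩
      1 · (x ^ᴿ p * y ^ᴿ (p ∸ p))         ≈⟨ ×-homo-1 _ ⟩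
      x ^ᴿ p * y ^ᴿ (p ∸ p)               ≈⟨ *-congˡ (reflexive (≡.cong (y ^ᴿ_) (ℕP.n∸n≡0 p))) ⟩
      x ^ᴿ p * 1#                         ≈⟨ *-identityʳ _ ⟩
      x ^ᴿ p                              ≈⟨ sym (↑≈^ x p) ⟩
      x ↑ p                               ∎

module TwistedSeries {c ℓ : Level} (R : CommutativeRing c ℓ) (q : ℕ)
  (additive-q : AdditiveExponents.Additive R q) (q≢0 : NonZero q) where
  open CommutativeRing R
  open import Relation.Binary.Reasoning.Setoid setoid
  open import Algebra.Properties.Ring ring using (-‿distribʳ-*)
  open Sums R
  open Divisibility R
  open Powers R
  open AdditiveExponents R

  φ : ℕ → Carrier → Carrier
  φ i x = x ↑ (q ^ i)

  φ-cong : ∀ i {x y} → x ≈ y → φ i x ≈ φ i y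
  φ-cong i = ↑-cong (q ^ i)

  φ-0 : ∀ i → φ i 0# ≈ 0#
  φ-0 i = additive-0 {q ^ i} (additive-^ {q} additive-q i)

  φ-1 : ∀ i → φ i 1# ≈ 1#
  φ-1 i = 1↑ (q ^ i)

  φ-* : ∀ i x y → φ i (x * y) ≈ φ i x * φ i y
  φ-* i x y = ↑-distrib-* x y (q ^ i)

  φ-∑ : ∀ i n (f : ℕ → Carrier) → φ i (∑ n f) ≈ ∑ n (φ i ∘ f)
  φ-∑ i = additive-∑ {q ^ i} (additive-^ {q} additive-q i)

  φ-φ : ∀ i j x → φ i (φ j x) ≈ φ (i ℕ.+ j) x
  φ-φ i j x = begin
    (x ↑ (q ^ j)) ↑ (q ^ i)    ≈⟨ sym (↑-* x (q ^ j) (q ^ i)) ⟩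
    x ↑ (q ^ j ℕ.* q ^ i)      ≈⟨ reflexive (≡.cong (x ↑_) exponents) ⟩
    x ↑ (q ^ (i ℕ.+ j))        ∎
    where
    exponents : q ^ j ℕ.* q ^ i ≡ q ^ (i ℕ.+ j)
    exponents = ≡.trans (ℕP.*-comm (q ^ j) (q ^ i)) (≡.sym (ℕP.^-distribˡ-+-* q i j))

  φ-∣ : ∀ i {a x} → a ∣ x → a ∣ φ i x
  φ-∣ i = ∣-↑ (q ^ i) {{ℕP.m^n≢0 q i {{q≢0}}}}

  infixr 9 _∘ₛ_
  _∘ₛ_ : Series R → Series R → Series R
  _∘ₛ_ = compose R q

  infix 4 _≋_
  _≋_ : Series R → Series R → Set ℓ
  _≋_ = _≈S_ R

  ∘-cong : ∀ {f f' g g'} → f ≋ f' → g ≋ g' → f ∘ₛ g ≋ f' ∘ₛ g'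
  ∘-cong f≋f' g≋g' n = ∑-cong n (λ i → *-cong (f≋f' i) (φ-cong i (g≋g' (n ∸ i))))

  ∘-identityˡ : ∀ f → idS R ∘ₛ f ≋ f
  ∘-identityˡ f n = trans (∑-first n (λ i _ → zeroˡ _)) (trans (*-identityˡ _) (*-identityʳ _))

  idS-∸ : ∀ n i → i <ℕ n → idS R (n ∸ i) ≡ 0#
  idS-∸ (suc n) zero    _         = ≡.refl
  idS-∸ (suc n) (suc i) (s≤s i<n) = idS-∸ n i i<n

  ∘-identityʳ : ∀ f → f ∘ₛ idS R ≋ f
  ∘-identityʳ f n = trans (∑-last n vanish) last
    where
    vanish : ∀ i → i <ℕ n → f i * φ i (idS R (n ∸ i)) ≈ 0#
    vanish i i<n = trans (*-congˡ (trans (φ-cong i (reflexive (idS-∸ n i i<n))) (φ-0 i))) (zeroʳ _)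
    last : f n * φ n (idS R (n ∸ n)) ≈ f n
    last = trans (*-congˡ (trans (φ-cong n (reflexive (≡.cong (idS R) (ℕP.n∸n≡0 n)))) (φ-1 n)))
                 (*-identityʳ _)

  -- Associativity: both ((b ∘ c) ∘ d)ₙ and (b ∘ (c ∘ d))ₙ expand to the
  -- sum of  bᵢ φᵢ(cⱼ) φ_{i+j}(d_{n-i-j})  over i + j ≤ n, in the two orders
  -- of summation related by ∑-triangle.
  module _ (b c d : Series R) (n : ℕ) where
    private
      term : ℕ → ℕ → Carrier
      term i j = b i * (φ i (c j) * φ (i ℕ.+ j) (d (n ∸ (i ℕ.+ j))))

    ∘-assoc-left : ((b ∘ₛ c) ∘ₛ d) n ≈ ∑ n (λ k → ∑ k (λ i → term i (k ∸ i)))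
    ∘-assoc-left = ∑-cong n (λ k → trans (∑-*ʳ k _ _) (∑-cong≤ k (λ i i≤k →
      trans (*-assoc _ _ _) (*-congˡ (*-congˡ (reflexive
        (≡.cong (λ m → φ m (d (n ∸ m))) (≡.sym (ℕP.m+[n∸m]≡n i≤k)))))))))

    ∘-assoc-right : (b ∘ₛ (c ∘ₛ d)) n ≈ ∑ n (λ i → ∑ (n ∸ i) (term i))
    ∘-assoc-right = ∑-cong n λ i → begin
      b i * φ i (∑ (n ∸ i) (λ j → c j * φ j (d (n ∸ i ∸ j))))
        ≈⟨ *-congˡ (φ-∑ i (n ∸ i) _) ⟩
      b i * ∑ (n ∸ i) (λ j → φ i (c j * φ j (d (n ∸ i ∸ j))))
        ≈⟨ ∑-*ˡ (n ∸ i) (b i) _ ⟩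
      ∑ (n ∸ i) (λ j → b i * φ i (c j * φ j (d (n ∸ i ∸ j))))
        ≈⟨ ∑-cong (n ∸ i) (λ j → *-congˡ (trans (φ-* i _ _) (*-congˡ (trans (φ-φ i j _)
             (reflexive (≡.cong (λ m → φ (i ℕ.+ j) (d m)) (ℕP.∸-+-assoc n i j))))))) ⟩
      ∑ (n ∸ i) (term i)
        ∎

  ∘-assoc : ∀ b c d → (b ∘ₛ c) ∘ₛ d ≋ b ∘ₛ (c ∘ₛ d)
  ∘-assoc b c d n =
    trans (∘-assoc-left b c d n) (trans (∑-triangle n _) (sym (∘-assoc-right b c d n)))

  right-inverse-twice : ∀ {f g e} → f ∘ₛ g ≋ idS R → g ∘ₛ e ≋ idS R → g ∘ₛ f ≋ idS R
  right-inverse-twice {f} {g} {e} fg≋1 ge≋1 n =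
    trans (∘-cong {g} (λ _ → refl) f≋e n) (ge≋1 n)
    where
    f≋e : f ≋ e
    f≋e m = begin
      f m                     ≈⟨ sym (∘-identityʳ f m) ⟩
      (f ∘ₛ idS R) m          ≈⟨ ∘-cong {f} (λ _ → refl) (λ k → sym (ge≋1 k)) m ⟩
      (f ∘ₛ (g ∘ₛ e)) m       ≈⟨ sym (∘-assoc f g e m) ⟩
      ((f ∘ₛ g) ∘ₛ e) m       ≈⟨ ∘-cong {g = e} {g' = e} fg≋1 (λ _ → refl) m ⟩
      (idS R ∘ₛ e) m          ≈⟨ ∘-identityˡ e m ⟩
      e m                     ∎

  -- A series b with b₀ u = 1 has a right inverse c, whose coefficients solve
  --   (b ∘ c)₀ = b₀ c₀ = 1,   (b ∘ c)_{n+1} = b₀ c_{n+1} + higher c n = 0.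
  module RightInverse (b : Series R) (u : Carrier) (b₀u≈1 : b 0 * u ≈ 1#) where

    -- The terms of (b ∘ c)_{n+1} other than b₀ c_{n+1}; they involve c₀, …, cₙ only.
    higher : Series R → ℕ → Carrier
    higher c n = ∑ n (λ i → b (suc i) * φ (suc i) (c (n ∸ i)))

    higher-cong : ∀ {c c'} n → (∀ m → m ≤ℕ n → c m ≈ c' m) → higher c n ≈ higher c' n
    higher-cong n c≈c' =
      ∑-cong≤ n (λ i i≤n → *-congˡ (φ-cong (suc i) (c≈c' (n ∸ i) (ℕP.m∸n≤m n i))))

    -- The recursion  c₀ = u,  c_{n+1} = - u · higher c n,  run with a budget
    -- of recursive calls; `coeff budget m` is correct as soon as m < budget.
    coeff : ℕ → ℕ → Carrier
    coeff zero         m       = 0#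
    coeff (suc budget) zero    = u
    coeff (suc budget) (suc n) = - (u * higher (coeff budget) n)

    inverse : Series R
    inverse n = coeff (suc n) n

    coeff-stable : ∀ budget m → m <ℕ budget → coeff budget m ≈ coeff (suc budget) m
    coeff-stable (suc budget) zero    _         = refl
    coeff-stable (suc budget) (suc n) (s≤s n<b) = -‿cong (*-congˡ (higher-cong n (λ m m≤n →
      coeff-stable budget m (ℕP.≤-<-trans m≤n n<b))))

    coeff≈inverse : ∀ budget m → m <ℕ budget → coeff budget m ≈ inverse m
    coeff≈inverse (suc budget) m m<1+b with ℕP.m<1+n⇒m<n∨m≡n m<1+b
    ... | inj₂ ≡.refl = refl
    ... | inj₁ m<b    = trans (sym (coeff-stable budget m m<b)) (coeff≈inverse budget m m<b)

    right-inverse : b ∘ₛ inverse ≋ idS R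
    right-inverse zero    = trans (*-congˡ (*-identityʳ u)) b₀u≈1
    right-inverse (suc n) = begin
      (b ∘ₛ inverse) (suc n)                  ≈⟨ ∑-suc n _ ⟩
      b 0 * φ 0 (inverse (suc n)) + higher inverse n
        ≈⟨ +-cong (*-congˡ (*-identityʳ _)) (higher-cong n (λ m m≤n → sym (coeff≈inverse (suc n) m (s≤s m≤n)))) ⟩
      b 0 * - (u * H) + H                     ≈⟨ +-congʳ (sym (-‿distribʳ-* _ _)) ⟩
      - (b 0 * (u * H)) + H                   ≈⟨ +-congʳ (-‿cong (sym (*-assoc _ _ _))) ⟩
      - ((b 0 * u) * H) + H                   ≈⟨ +-congʳ (-‿cong (trans (*-congʳ b₀u≈1) (*-identityˡ H))) ⟩
      - H + H                                 ≈⟨ -‿inverseˡ H ⟩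
      0#                                      ∎
      where H = higher (coeff (suc n)) n

    -- If bᵢ ∈ πⁱR for all i, then also cₘ ∈ πᵐR: every term of higher c n
    -- lies in π^{i+1} π^{n-i} R = π^{n+1} R.
    module _ (π : Carrier) (b-small : ∀ i → π ↑ i ∣ b i) where
      coeff-small : ∀ budget m → π ↑ m ∣ coeff budget m
      coeff-small zero         m       = ∣-0 _
      coeff-small (suc budget) zero    = u , sym (*-identityˡ u)
      coeff-small (suc budget) (suc n) = ∣-neg (∣-*ˡ u (∣-∑ n (λ i i≤n →
        ∣-respˡ (∣-* (b-small (suc i)) (φ-∣ (suc i) (coeff-small budget (n ∸ i))))
                (↑-split π (s≤s i≤n)))))

      inverse-small : ∀ m → π ↑ m ∣ inverse m
      inverse-small m = coeff-small (suc m) m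

  module Sdagger (π : Carrier) where

    Small : Series R → Set (c ⊔ ℓ)
    Small b = ∀ i → π ↑ i ∣ b i

    S† : Series R → Set (c ⊔ ℓ)
    S† b = TendsToZero R π b × InSdagger R π b

    -- bᵢ ∈ πⁱR forces bᵢ → 0 π-adically: πⁿ ∣ πⁱ for i ≥ n.
    small⇒tendsToZero : ∀ {b} → Small b → TendsToZero R π b
    small⇒tendsToZero b-small n =
      n , λ i n≤i → ∣-trans (π ↑ (i ∸ n) , sym (↑-split π n≤i)) (b-small i)

    S†-intro : ∀ {b} → Small b → IsUnit R (b 0) → S† b
    S†-intro b-small b₀-unit = small⇒tendsToZero b-small , b-small , b₀-unit

    -- Each term bᵢ φᵢ(c_{n-i}) of (b ∘ c)ₙ lies in πⁱ π^{n-i} R = πⁿ R.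
    small-∘ : ∀ {b c} → Small b → Small c → Small (b ∘ₛ c)
    small-∘ b-small c-small n = ∣-∑ n (λ i i≤n →
      ∣-respˡ (∣-* (b-small i) (φ-∣ i (c-small (n ∸ i)))) (↑-split π i≤n))

    small-id : Small (idS R)
    small-id zero    = 1# , sym (*-identityˡ 1#)
    small-id (suc i) = ∣-0 _

    -- (b ∘ c)₀ = b₀ c₀.
    unit-∘ : ∀ {b c} → IsUnit R (b 0) → IsUnit R (c 0) → IsUnit R ((b ∘ₛ c) 0)
    unit-∘ b₀-unit c₀-unit = unit-* b₀-unit (unit-resp c₀-unit (sym (*-identityʳ _)))

    S†-resp : ∀ {b b'} → S† b → b ≋ b' → S† b'
    S†-resp (_ , b-small , b₀-unit) b≋b' =
      S†-intro (λ i → ∣-respʳ (b-small i) (b≋b' i)) (unit-resp b₀-unit (b≋b' 0))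

    S†-closed : ∀ {b c} → S† b → S† c → S† (b ∘ₛ c)
    S†-closed {b} {c} (_ , b-small , b₀-unit) (_ , c-small , c₀-unit) =
      S†-intro (small-∘ b-small c-small) (unit-∘ {b} {c} b₀-unit c₀-unit)

    S†-right-inverse : ∀ {b} → S† b → Σ (Series R) (λ c → S† c × (b ∘ₛ c ≋ idS R))
    S†-right-inverse {b} (_ , b-small , (u , b₀u≈1)) =
      inverse , S†-intro (inverse-small π b-small) (b 0 , trans (*-comm u (b 0)) b₀u≈1) , right-inverse
      where open RightInverse b u b₀u≈1

    -- The right inverse c of b has itself a right inverse, so it is two-sided.
    S†-inverse : ∀ {b} → S† b → Σ (Series R) (λ c → S† c × (b ∘ₛ c ≋ idS R) × (c ∘ₛ b ≋ idS R))
    S†-inverse {b} b∈S† with S†-right-inverse b∈S†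
    ... | c , c∈S† , bc≋1 with S†-right-inverse c∈S†
    ...   | e , _ , ce≋1 = c , c∈S† , bc≋1 , right-inverse-twice {b} {c} {e} bc≋1 ce≋1

    S†-group : IsGroupUnder R _∘ₛ_ S†
    S†-group = record
      { resp      = S†-resp
      ; cong      = λ _ _ _ _ → ∘-cong
      ; closed    = S†-closed
      ; id∈       = S†-intro small-id (1# , *-identityˡ 1#)
      ; assoc     = λ {b} {c} {d} _ _ _ → ∘-assoc b c d
      ; identityˡ = λ {b} _ → ∘-identityˡ b
      ; identityʳ = λ {b} _ → ∘-identityʳ b
      ; inverse   = S†-inverse
      }

proposition5p3 : {c ℓ : Level} (R : CommutativeRing c ℓ) (p h q : ℕ) → Prime p → q ≡ p ^ suc h →
                 CommutativeRing._≈_ R (natCast R p) (CommutativeRing.0# R) →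
                 (π : CommutativeRing.Carrier R) → PiAdicallyComplete R π → TorsionFree R π →
                 IsGroupUnder R (compose R q) (λ b → TendsToZero R π b × InSdagger R π b)
proposition5p3 R p h q p-prime ≡.refl char π _ _ = TwistedSeries.Sdagger.S†-group R q additive-q q≢0 π
  where
  open AdditiveExponents R using (Additive; additive-^)
  additive-q : Additive (p ^ suc h)
  additive-q = additive-^ {p} (Frobenius.frobenius R p p-prime char) (suc h)
  q≢0 : NonZero (p ^ suc h)
  q≢0 = ℕP.m^n≢0 p (suc h) {{prime⇒nonZero p-prime}}
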